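{- Let $A$ and $B$ be subtraction algebras and $h:A\to B$ a homomorphism (i.e. $h(a-b)=h(a)-h(b)$). If $h$ is meet complete, then it is join complete.
   Context: A subtraction algebra is a set with a binary operation $-$ satisfying $a-(b-a)=a$, $a-(a-b)=b-(b-a)$, and $(a-b)-c=(a-c)-b$. Writing $a\cdot b:=a-(a-b)$, it is a meet-semilattice ordered by $a\le b\iff a\cdot b=a$, with least element $0=a-a$. A map $h:A\to B$ between posets is meet complete if for every nonempty $S\subseteq A$ whose meet $\bigwedge S$ exists in $A$, the meet of $h[S]$ exists in $B$ and equals $h(\bigwedge S)$; it is join complete if for every $S\subseteq A$ whose join $\bigvee S$ exists in $A$, the join of $h[S]$ exists in $B$ and equals $h(\bigvee S)$. -}

module Defs where

open import Level using (Level; suc; _⊔_)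
open import Data.Product using (Σ; _×_; ∃)
open import Relation.Binary.PropositionalEquality using (_≡_)

record SubtractionAlgebra (c : Level) : Set (suc c) where
  infixl 6 _-_
  field
    Carrier : Set c
    _-_     : Carrier → Carrier → Carrier
    sub-absorb : ∀ a b → a - (b - a) ≡ a
    sub-comm   : ∀ a b → a - (a - b) ≡ b - (b - a)
    sub-swap   : ∀ a b c → (a - b) - c ≡ (a - c) - b

  _·_ : Carrier → Carrier → Carrier
  a · b = a - (a - b)

  _≤_ : Carrier → Carrier → Set c
  a ≤ b = a · b ≡ a

open SubtractionAlgebra public using (Carrier)

module _ {c : Level} (A : SubtractionAlgebra c) where
  open SubtractionAlgebra A hiding (Carrier)

  Subset : Set (suc c)
  Subset = Carrier A → Set c

  IsLowerBound : Subset → Carrier A → Set c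
  IsLowerBound S m = ∀ x → S x → m ≤ x

  IsUpperBound : Subset → Carrier A → Set c
  IsUpperBound S m = ∀ x → S x → x ≤ m

  IsMeet : Subset → Carrier A → Set c
  IsMeet S m = IsLowerBound S m × (∀ l → IsLowerBound S l → l ≤ m)

  IsJoin : Subset → Carrier A → Set c
  IsJoin S m = IsUpperBound S m × (∀ u → IsUpperBound S u → m ≤ u)

  Nonempty : Subset → Set c
  Nonempty S = ∃ S

module _ {a b : Level} (A : SubtractionAlgebra a) (B : SubtractionAlgebra b) where
  private
    module A = SubtractionAlgebra A
    module B = SubtractionAlgebra B

  IsHomomorphism : (Carrier A → Carrier B) → Set (a ⊔ b)
  IsHomomorphism h = ∀ x y → h (x A.- y) ≡ h x B.- h y

  Image : (Carrier A → Carrier B) → Subset A → Carrier B → Set (a ⊔ b)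
  Image h S y = Σ (Carrier A) λ x → S x × h x ≡ y

  MeetComplete : (Carrier A → Carrier B) → Set (suc a ⊔ b)
  MeetComplete h = ∀ (S : Subset A) (m : Carrier A) →
    Nonempty A S → IsMeet A S m → IsMeetB (Image h S) (h m)
    where
      IsMeetB : (Carrier B → Set (a ⊔ b)) → Carrier B → Set (a ⊔ b)
      IsMeetB T m = (∀ y → T y → m B.≤ y) × (∀ l → (∀ y → T y → l B.≤ y) → l B.≤ m)

  JoinComplete : (Carrier A → Carrier B) → Set (suc a ⊔ b)
  JoinComplete h = ∀ (S : Subset A) (m : Carrier A) →
    IsJoin A S m → IsJoinB (Image h S) (h m)
    where
      IsJoinB : (Carrier B → Set (a ⊔ b)) → Carrier B → Set (a ⊔ b)
      IsJoinB T m = (∀ y → T y → y B.≤ m) × (∀ u → (∀ y → T y → y B.≤ u) → m B.≤ u)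

module Submission where

-- Let m be the join of S. In the interval [0, m] the element m - x is the relative complement
-- of x, so the set T = {m} ∪ {m - x | x ∈ S} has meet 0: a lower bound l of T is disjoint from
-- every x ∈ S, hence every x lies below m - l, hence m ≤ m - l and l = 0. Meet completeness
-- makes h 0 = 0 the meet of h[T]. For an upper bound u of h[S], h m - u lies below h m and
-- below every h m - h x = h (m - x), so h m - u = 0, i.e. h m ≤ u.

open import Level using (Level)
open import Data.Product using (Σ; _×_; _,_; proj₂)
open import Data.Sum using (_⊎_; inj₁; inj₂)
open import Relation.Binary.PropositionalEquality
open ≡-Reasoning

open import Defs

module SubtractionAlgebraProperties {c : Level} (A : SubtractionAlgebra c) where
  open SubtractionAlgebra A

  private
    [x-x]-x≡x-x : ∀ x → (x - x) - x ≡ x - x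
    [x-x]-x≡x-x x = begin
      (x - x) - x              ≡⟨ cong ((x - x) -_) (sym (sub-absorb x x)) ⟩
      (x - x) - (x - (x - x))  ≡⟨ sub-absorb (x - x) x ⟩
      x - x                    ∎

    [x-x]-[y-x]≡x-x : ∀ x y → (x - x) - (y - x) ≡ x - x
    [x-x]-[y-x]≡x-x x y = begin
      (x - x) - (y - x)  ≡⟨ sub-swap x (y - x) x ⟨
      (x - (y - x)) - x  ≡⟨ cong (_- x) (sub-absorb x y) ⟩
      x - x              ∎

    x·[y-y]≡y-y : ∀ x y → x · (y - y) ≡ y - y
    x·[y-y]≡y-y x y = begin
      x - (x - (y - y))        ≡⟨ sub-comm x (y - y) ⟩
      (y - y) - ((y - y) - x)  ≡⟨ cong ((y - y) -_) (sub-swap y y x) ⟩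
      (y - y) - ((y - x) - y)  ≡⟨ [x-x]-[y-x]≡x-x y (y - x) ⟩
      y - y                    ∎

  x-x≡y-y : ∀ x y → x - x ≡ y - y
  x-x≡y-y x y = begin
    x - x                    ≡⟨ x·[y-y]≡y-y (y - y) x ⟨
    (y - y) · (x - x)        ≡⟨ sub-comm (y - y) (x - x) ⟩
    (x - x) · (y - y)        ≡⟨ x·[y-y]≡y-y (x - x) y ⟩
    y - y                    ∎

  x-[y-y]≡x : ∀ x y → x - (y - y) ≡ x
  x-[y-y]≡x x y = trans (cong (x -_) (x-x≡y-y y x)) (sub-absorb x x)

  [y-y]-x≡y-y : ∀ x y → (y - y) - x ≡ y - y
  [y-y]-x≡y-y x y = begin
    (y - y) - x  ≡⟨ cong (_- x) (x-x≡y-y y x) ⟩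
    (x - x) - x  ≡⟨ [x-x]-x≡x-x x ⟩
    x - x        ≡⟨ x-x≡y-y x y ⟩
    y - y        ∎

  x≤y⇒x-y≡z-z : ∀ {x y} → x ≤ y → ∀ z → x - y ≡ z - z
  x≤y⇒x-y≡z-z {x} {y} x≤y z = begin
    x - y              ≡⟨ cong (_- y) x≤y ⟨
    (x - (x - y)) - y  ≡⟨ sub-swap x (x - y) y ⟩
    (x - y) - (x - y)  ≡⟨ x-x≡y-y (x - y) z ⟩
    z - z              ∎

  x-y≡z-z⇒x≤y : ∀ {x y} z → x - y ≡ z - z → x ≤ y
  x-y≡z-z⇒x≤y {x} z x-y≡0 = trans (cong (x -_) x-y≡0) (x-[y-y]≡x x z)

  x≤y⇒y-[y-x]≡x : ∀ {x y} → x ≤ y → y - (y - x) ≡ x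
  x≤y⇒y-[y-x]≡x {x} {y} x≤y = trans (sym (sub-comm x y)) x≤y

  x-x≤y : ∀ x y → (x - x) ≤ y
  x-x≤y x y = x-y≡z-z⇒x≤y x ([y-y]-x≡y-y y x)

  x-y≤x : ∀ x y → (x - y) ≤ x
  x-y≤x x y = x-y≡z-z⇒x≤y x (trans (sym (sub-swap x x y)) ([y-y]-x≡y-y y x))

  x≤y-y⇒x≡y-y : ∀ {x} y → x ≤ (y - y) → x ≡ y - y
  x≤y-y⇒x≡y-y {x} y x≤0 = begin
    x                  ≡⟨ x≤0 ⟨
    x - (x - (y - y))  ≡⟨ cong (x -_) (x-[y-y]≡x x y) ⟩
    x - x              ≡⟨ x-x≡y-y x y ⟩
    y - y              ∎

  ≤-trans : ∀ {x y z} → x ≤ y → y ≤ z → x ≤ z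
  ≤-trans {x} {y} {z} x≤y y≤z = x-y≡z-z⇒x≤y x (begin
    x - z              ≡⟨ cong (_- z) (x≤y⇒y-[y-x]≡x x≤y) ⟨
    (y - (y - x)) - z  ≡⟨ sub-swap y (y - x) z ⟩
    (y - z) - (y - x)  ≡⟨ cong (_- (y - x)) (x≤y⇒x-y≡z-z y≤z y) ⟩
    (y - y) - (y - x)  ≡⟨ [y-y]-x≡y-y (y - x) y ⟩
    y - y              ≡⟨ x-x≡y-y y x ⟩
    x - x              ∎)

  -‿antitoneʳ : ∀ x {y z} → y ≤ z → (x - z) ≤ (x - y)
  -‿antitoneʳ x {y} {z} y≤z = x-y≡z-z⇒x≤y x (begin
    (x - z) - (x - y)        ≡⟨ cong (_- (x - y)) [x-z]-y≡x-z ⟨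
    ((x - z) - y) - (x - y)  ≡⟨ cong (_- (x - y)) (sub-swap x z y) ⟩
    ((x - y) - z) - (x - y)  ≡⟨ sub-swap (x - y) z (x - y) ⟩
    ((x - y) - (x - y)) - z  ≡⟨ [y-y]-x≡y-y z (x - y) ⟩
    (x - y) - (x - y)        ≡⟨ x-x≡y-y (x - y) x ⟩
    x - x                    ∎)
    where
    y-[x-z]≡y : y - (x - z) ≡ y
    y-[x-z]≡y = begin
      y - (x - z)              ≡⟨ cong (_- (x - z)) (x≤y⇒y-[y-x]≡x y≤z) ⟨
      (z - (z - y)) - (x - z)  ≡⟨ sub-swap z (z - y) (x - z) ⟩
      (z - (x - z)) - (z - y)  ≡⟨ cong (_- (z - y)) (sub-absorb z x) ⟩
      z - (z - y)              ≡⟨ x≤y⇒y-[y-x]≡x y≤z ⟩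
      y                        ∎

    [x-z]-y≡x-z : (x - z) - y ≡ x - z
    [x-z]-y≡x-z = trans (cong ((x - z) -_) (sym y-[x-z]≡y)) (sub-absorb (x - z) y)

  -- Below m, "l ≤ m - x" says that l and x are disjoint, a symmetric relation.
  ≤-complement-swap : ∀ {x l m} → x ≤ m → l ≤ m → l ≤ (m - x) → x ≤ (m - l)
  ≤-complement-swap {x} {l} {m} x≤m l≤m l≤m-x = x-y≡z-z⇒x≤y x (begin
    x - (m - l)              ≡⟨ cong (_- (m - l)) (x≤y⇒y-[y-x]≡x x≤m) ⟨
    (m - (m - x)) - (m - l)  ≡⟨ sub-swap m (m - x) (m - l) ⟩
    (m - (m - l)) - (m - x)  ≡⟨ cong (_- (m - x)) (x≤y⇒y-[y-x]≡x l≤m) ⟩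
    l - (m - x)              ≡⟨ x≤y⇒x-y≡z-z l≤m-x x ⟩
    x - x                    ∎)

module _ {c : Level} (A : SubtractionAlgebra c) where
  open SubtractionAlgebra A
  open SubtractionAlgebraProperties A

  JoinComplements : Subset A → Carrier A → Subset A
  JoinComplements S m t = (t ≡ m) ⊎ Σ (Carrier A) λ x → S x × t ≡ m - x

  joinComplements-meet : ∀ {S m} → IsJoin A S m → IsMeet A (JoinComplements S m) (m - m)
  joinComplements-meet {S} {m} (m-upper , m-least) =
    (λ t _ → x-x≤y m t) ,
    λ l l-lower → subst (_≤ (m - m)) (sym (lower≡m-m l l-lower)) (x-x≤y m (m - m))
    where
    lower≡m-m : ∀ l → IsLowerBound A (JoinComplements S m) l → l ≡ m - m
    lower≡m-m l l-lower = begin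
      l                  ≡⟨ l≤m-l ⟨
      l - (l - (m - l))  ≡⟨ cong (l -_) (sub-absorb l m) ⟩
      l - l              ≡⟨ x-x≡y-y l m ⟩
      m - m              ∎
      where
      l≤m : l ≤ m
      l≤m = l-lower m (inj₁ refl)

      m-l-upper : IsUpperBound A S (m - l)
      m-l-upper x Sx =
        ≤-complement-swap (m-upper x Sx) l≤m (l-lower (m - x) (inj₂ (x , Sx , refl)))

      l≤m-l : l ≤ (m - l)
      l≤m-l = ≤-trans l≤m (m-least (m - l) m-l-upper)

module _ {a b : Level} (A : SubtractionAlgebra a) (B : SubtractionAlgebra b)
         (h : Carrier A → Carrier B) (hom : IsHomomorphism A B h) where
  private
    module A = SubtractionAlgebra A
    module B = SubtractionAlgebra B

  homomorphism-monotone : ∀ {x y} → x A.≤ y → h x B.≤ h y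
  homomorphism-monotone {x} {y} x≤y = begin
    h x B.- (h x B.- h y)  ≡⟨ cong (h x B.-_) (hom x y) ⟨
    h x B.- h (x A.- y)    ≡⟨ hom x (x A.- y) ⟨
    h (x A.- (x A.- y))    ≡⟨ cong h x≤y ⟩
    h x                    ∎

corollary6p5 : {a b : Level} (A : SubtractionAlgebra a) (B : SubtractionAlgebra b)
    (h : Carrier A → Carrier B) → IsHomomorphism A B h →
    MeetComplete A B h → JoinComplete A B h
corollary6p5 A B h hom meetComplete S m m-join@(m-upper , _) = hm-upper , hm-least
  where
  open SubtractionAlgebra B
  open SubtractionAlgebraProperties B
  module A = SubtractionAlgebra A

  hm-upper : ∀ y → Image A B h S y → y ≤ h m
  hm-upper _ (x , Sx , refl) = homomorphism-monotone A B h hom (m-upper x Sx)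

  hm-least : ∀ u → (∀ y → Image A B h S y → y ≤ u) → h m ≤ u
  hm-least u u-upper = x-y≡z-z⇒x≤y (h m) (x≤y-y⇒x≡y-y (h m) hm-u≤hm-hm)
    where
    hm-u-lower : ∀ y → Image A B h (JoinComplements A S m) y → (h m - u) ≤ y
    hm-u-lower _ (_ , inj₁ refl , refl) = x-y≤x (h m) u
    hm-u-lower _ (_ , inj₂ (x , Sx , refl) , refl) =
      subst ((h m - u) ≤_) (sym (hom m x)) (-‿antitoneʳ (h m) (u-upper (h x) (x , Sx , refl)))

    hm-u≤hm-hm : (h m - u) ≤ (h m - h m)
    hm-u≤hm-hm = subst ((h m - u) ≤_) (hom m m) (h[m-m]-greatest (h m - u) hm-u-lower)
      where
      h[m-m]-greatest : ∀ l → (∀ y → Image A B h (JoinComplements A S m) y → l ≤ y) →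
                        l ≤ h (m A.- m)
      h[m-m]-greatest = proj₂ (meetComplete (JoinComplements A S m) (m A.- m) (m , inj₁ refl)
                                            (joinComplements-meet A m-join))
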